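{- For any integers $r,t\ge 3$, $\left((K_r\times K_t)_{SR}\right)_{SR}\cong K_r\times K_t$.
   Context: All graphs are finite, simple and undirected; $d_G$ is the distance in $G$. $K_m$ is the complete graph on $m$ vertices. The direct product $G\times H$ has vertex set $V(G)\times V(H)$, with $(a,b)\sim(c,d)$ iff $ac\in E(G)$ and $bd\in E(H)$. A vertex $u$ is maximally distant from $v$ if $d_G(v,w)\le d_G(u,v)$ for every neighbor $w$ of $u$. Vertices $u,v$ are mutually maximally distant (MMD) if each is maximally distant from the other. The boundary $\partial(G)$ is the set of vertices maximally distant from some vertex of $G$. The strong resolving graph $G_{SR}$ has vertex set $\partial(G)$, two vertices being adjacent iff they are MMD in $G$. -}

module Defs where

open import Level using (0ℓ)
open import Data.Nat using (ℕ; zero; suc; _≤_)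
open import Data.Fin using (Fin)
open import Data.Product using (Σ; ∃; ∃-syntax; _×_; _,_; proj₁; proj₂)
open import Relation.Nullary using (¬_)
open import Relation.Binary using (IsEquivalence)
open import Relation.Binary.PropositionalEquality using (_≡_; refl; sym; trans; isEquivalence)

-- Using a setoid of vertices lets subgraphs on a vertex
-- subset Σ V P be formed without caring about the proof of P.
record Graph : Set₁ where
  field
    V       : Set
    _≈_     : V → V → Set
    ≈-equiv : IsEquivalence _≈_
    Adj     : V → V → Set
    Adj-sym : ∀ {u v} → Adj u v → Adj v u
    Adj-irr : ∀ {u v} → Adj u v → ¬ (u ≈ v)
    Adj-resp : ∀ {u u′ v v′} → u ≈ u′ → v ≈ v′ → Adj u v → Adj u′ v′

module _ (G : Graph) where
  open Graph G
  private module E = IsEquivalence ≈-equiv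

  data Walk : V → V → ℕ → Set where
    here  : ∀ {u v} → u ≈ v → Walk u v zero
    there : ∀ {u w v k} → Adj u w → Walk w v k → Walk u v (suc k)

  DistLe : V → V → ℕ → Set
  DistLe u v k = ∃[ j ] (j ≤ k × Walk u v j)

  -- d_G(v,w) ≤ d_G(v,u)   (with d = ∞ for disconnected pairs)
  DistLeDist : V → V → V → Set
  DistLeDist v w u = ∀ k → DistLe v u k → DistLe v w k

  MaxDist : V → V → Set
  MaxDist u v = ∀ w → Adj u w → DistLeDist v w u

  MMD : V → V → Set
  MMD u v = MaxDist u v × MaxDist v u

  InBoundary : V → Set
  InBoundary u = ∃[ v ] MaxDist u v

  walk-resp : ∀ {u u′ v v′ k} → u ≈ u′ → v ≈ v′ → Walk u v k → Walk u′ v′ k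
  walk-resp p q (here r) = here (E.trans (E.sym p) (E.trans r q))
  walk-resp p q (there a w) = there (Adj-resp p E.refl a) (walk-resp E.refl q w)

  distLe-resp : ∀ {u u′ v v′ k} → u ≈ u′ → v ≈ v′ → DistLe u v k → DistLe u′ v′ k
  distLe-resp p q (j , j≤k , w) = j , j≤k , walk-resp p q w

  maxDist-resp : ∀ {u u′ v v′} → u ≈ u′ → v ≈ v′ → MaxDist u v → MaxDist u′ v′
  maxDist-resp p q m w a k d =
    distLe-resp q E.refl
      (m w (Adj-resp (E.sym p) E.refl a) k (distLe-resp (E.sym q) (E.sym p) d))

SR : Graph → Graph
SR G = record
  { V = Σ V InBoundary′
  ; _≈_ = λ x y → proj₁ x ≈ proj₁ y
  ; ≈-equiv = record { refl = E.refl ; sym = E.sym ; trans = E.trans }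
  ; Adj = λ x y → ¬ (proj₁ x ≈ proj₁ y) × MMD G (proj₁ x) (proj₁ y)
  ; Adj-sym = λ { (n , m₁ , m₂) → (λ e → n (E.sym e)) , m₂ , m₁ }
  ; Adj-irr = proj₁
  ; Adj-resp = λ { p q (n , m₁ , m₂) →
        (λ e → n (E.trans p (E.trans e (E.sym q))))
      , maxDist-resp G p q m₁ , maxDist-resp G q p m₂ }
  }
  where
  open Graph G
  module E = IsEquivalence ≈-equiv
  InBoundary′ = InBoundary G

K : ℕ → Graph
K m = record
  { V = Fin m
  ; _≈_ = _≡_
  ; ≈-equiv = isEquivalence
  ; Adj = λ a b → ¬ (a ≡ b)
  ; Adj-sym = λ n e → n (sym e)
  ; Adj-irr = λ n → n
  ; Adj-resp = λ { refl refl n → n }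
  }

_×ᴳ_ : Graph → Graph → Graph
G ×ᴳ H = record
  { V = G.V × H.V
  ; _≈_ = λ x y → G._≈_ (proj₁ x) (proj₁ y) × H._≈_ (proj₂ x) (proj₂ y)
  ; ≈-equiv = record
      { refl = GE.refl , HE.refl
      ; sym = λ { (p , q) → GE.sym p , HE.sym q }
      ; trans = λ { (p , q) (p′ , q′) → GE.trans p p′ , HE.trans q q′ } }
  ; Adj = λ x y → G.Adj (proj₁ x) (proj₁ y) × H.Adj (proj₂ x) (proj₂ y)
  ; Adj-sym = λ { (a , b) → G.Adj-sym a , H.Adj-sym b }
  ; Adj-irr = λ { (a , b) (p , q) → G.Adj-irr a p }
  ; Adj-resp = λ { (p , q) (p′ , q′) (a , b) → G.Adj-resp p p′ a , H.Adj-resp q q′ b }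
  }
  where
  module G = Graph G
  module H = Graph H
  module GE = IsEquivalence G.≈-equiv
  module HE = IsEquivalence H.≈-equiv

record _≅_ (G H : Graph) : Set where
  private
    module G = Graph G
    module H = Graph H
  field
    to      : G.V → H.V
    from    : H.V → G.V
    to-cong   : ∀ {x y} → G._≈_ x y → H._≈_ (to x) (to y)
    from-cong : ∀ {x y} → H._≈_ x y → G._≈_ (from x) (from y)
    from-to : ∀ x → G._≈_ (from (to x)) x
    to-from : ∀ y → H._≈_ (to (from y)) y
    to-adj  : ∀ {x y} → G.Adj x y → H.Adj (to x) (to y)
    adj-to  : ∀ {x y} → H.Adj (to x) (to y) → G.Adj x y

-- In a graph of diameter at most 2, two distinct non-adjacent vertices are
-- always mutually maximally distant; if moreover every edge uv can be left
-- through a neighbour of u that is neither v nor a neighbour of v, then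
-- adjacent vertices never are.  K_r × K_t (r, t ≥ 3) is such a graph, so its
-- strong resolving graph is the rook's graph K_r □ K_t on all vertices: pairs
-- sharing a row or a column.  The rook's graph is again such a graph, and its
-- distinct non-adjacent pairs, those differing in both coordinates, are exactly
-- the edges of K_r × K_t.
module Submission where

open import Defs
open import Data.Nat using (ℕ; zero; suc; _+_; _≤_; z≤n; s≤s)
open import Data.Nat.Properties using (≤-refl; ≤-trans; +-mono-≤)
open import Data.Fin using (Fin; _≟_) renaming (zero to fz; suc to fs)
open import Data.Product using (∃-syntax; _×_; _,_; proj₁)
open import Data.Sum using (_⊎_; inj₁; inj₂)
open import Data.Empty using (⊥-elim)
open import Relation.Nullary using (¬_; Dec; yes; no; _×-dec_)
open import Relation.Binary using (IsEquivalence)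
open import Relation.Binary.PropositionalEquality using (_≡_; refl; sym)

module _ (G : Graph) where
  open Graph G
  private module E = IsEquivalence ≈-equiv

  Diameter≤2 : Set
  Diameter≤2 = ∀ u v → DistLe G u v 2

  Escape : V → V → Set
  Escape u v = ∃[ w ] (Adj u w × ¬ w ≈ v × ¬ Adj v w)

  walk-++ : ∀ {u v w j k} → Walk G u v j → Walk G v w k → Walk G u w (j + k)
  walk-++ (here u≈v) q = walk-resp G (E.sym u≈v) E.refl q
  walk-++ (there a p) q = there a (walk-++ p q)

  distLe-trans : ∀ {u v w j k} → DistLe G u v j → DistLe G v w k → DistLe G u w (j + k)
  distLe-trans (j′ , j′≤j , p) (k′ , k′≤k , q) = j′ + k′ , +-mono-≤ j′≤j k′≤k , walk-++ p q

  distLe-mono : ∀ {u v j k} → j ≤ k → DistLe G u v j → DistLe G u v k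
  distLe-mono j≤k (i , i≤j , p) = i , ≤-trans i≤j j≤k , p

  ≈⇒distLe : ∀ {u v k} → u ≈ v → DistLe G u v k
  ≈⇒distLe u≈v = 0 , z≤n , here u≈v

  Adj⇒distLe : ∀ {u v k} → Adj u v → 1 ≤ k → DistLe G u v k
  Adj⇒distLe a 1≤k = 1 , 1≤k , there a (here E.refl)

  distLe₁⇒≈⊎Adj : ∀ {u v} → DistLe G u v 1 → u ≈ v ⊎ Adj u v
  distLe₁⇒≈⊎Adj (zero , _ , here u≈v) = inj₁ u≈v
  distLe₁⇒≈⊎Adj (suc zero , _ , there a (here w≈v)) = inj₂ (Adj-resp E.refl w≈v a)
  distLe₁⇒≈⊎Adj (suc (suc _) , s≤s () , _)

  distLe-nonadjacent : ∀ {u v k} → ¬ u ≈ v → ¬ Adj u v → DistLe G u v k → 2 ≤ k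
  distLe-nonadjacent u≉v _ (zero , _ , here u≈v) = ⊥-elim (u≉v u≈v)
  distLe-nonadjacent _ ¬uv (suc zero , _ , there a (here w≈v)) = ⊥-elim (¬uv (Adj-resp E.refl w≈v a))
  distLe-nonadjacent _ _ (suc (suc _) , j≤k , _) = ≤-trans (s≤s (s≤s z≤n)) j≤k

  -- v is at distance 2 from u, which is already the diameter.
  maxDist-of-nonadjacent : Diameter≤2 → ∀ {u v} → ¬ v ≈ u → ¬ Adj v u → MaxDist G u v
  maxDist-of-nonadjacent diam {v = v} v≉u ¬vu w _ k d =
    distLe-mono (distLe-nonadjacent v≉u ¬vu d) (diam v w)

  mmd-of-nonadjacent : Diameter≤2 → ∀ {u v} → ¬ u ≈ v → ¬ Adj u v → MMD G u v
  mmd-of-nonadjacent diam u≉v ¬uv =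
      maxDist-of-nonadjacent diam (λ v≈u → u≉v (E.sym v≈u)) (λ vu → ¬uv (Adj-sym vu))
    , maxDist-of-nonadjacent diam u≉v ¬uv

  ¬maxDist-of-escape : ∀ {u v} → Adj u v → Escape u v → ¬ MaxDist G u v
  ¬maxDist-of-escape uv (w , uw , w≉v , ¬vw) max
    with distLe₁⇒≈⊎Adj (max w uw 1 (Adj⇒distLe (Adj-sym uv) ≤-refl))
  ... | inj₁ v≈w = w≉v (E.sym v≈w)
  ... | inj₂ vw = ¬vw vw

  mmd⇒nonadjacent : (∀ {u v} → Adj u v → Escape u v) → ∀ {u v} → MMD G u v → ¬ Adj u v
  mmd⇒nonadjacent escape (max , _) uv = ¬maxDist-of-escape uv (escape uv) max

avoid : ∀ {n} → 3 ≤ n → (b d : Fin n) → ∃[ y ] (¬ y ≡ b × ¬ y ≡ d)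
avoid (s≤s (s≤s (s≤s _))) fz fz = fs fz , (λ ()) , (λ ())
avoid (s≤s (s≤s (s≤s _))) fz (fs fz) = fs (fs fz) , (λ ()) , (λ ())
avoid (s≤s (s≤s (s≤s _))) fz (fs (fs _)) = fs fz , (λ ()) , (λ ())
avoid (s≤s (s≤s (s≤s _))) (fs fz) fz = fs (fs fz) , (λ ()) , (λ ())
avoid (s≤s (s≤s (s≤s _))) (fs fz) (fs _) = fz , (λ ()) , (λ ())
avoid (s≤s (s≤s (s≤s _))) (fs (fs _)) fz = fs fz , (λ ()) , (λ ())
avoid (s≤s (s≤s (s≤s _))) (fs (fs _)) (fs _) = fz , (λ ()) , (λ ())

module DirectProductOfCompleteGraphs {r t : ℕ} (3≤r : 3 ≤ r) (3≤t : 3 ≤ t) where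

  G : Graph
  G = K r ×ᴳ K t

  Rook : Graph
  Rook = SR G

  private
    module G = Graph G
    module Rook = Graph Rook

  Aligned : G.V → G.V → Set
  Aligned (a , b) (c , d) = a ≡ c ⊎ b ≡ d

  aligned⇒nonadjacent : ∀ {p q} → Aligned p q → ¬ G.Adj p q
  aligned⇒nonadjacent (inj₁ a≡c) (a≢c , _) = a≢c a≡c
  aligned⇒nonadjacent (inj₂ b≡d) (_ , b≢d) = b≢d b≡d

  nonadjacent⇒aligned : ∀ {p q} → ¬ G.Adj p q → Aligned p q
  nonadjacent⇒aligned {a , b} {c , d} ¬pq with a ≟ c | b ≟ d
  ... | yes a≡c | _ = inj₁ a≡c
  ... | no _ | yes b≡d = inj₂ b≡d
  ... | no a≢c | no b≢d = ⊥-elim (¬pq (a≢c , b≢d))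

  diameter-G : Diameter≤2 G
  diameter-G (a , b) (c , d) with avoid 3≤r a c | avoid 3≤t b d
  ... | x , x≢a , x≢c | y , y≢b , y≢d =
    distLe-trans G (Adj⇒distLe G ((λ a≡x → x≢a (sym a≡x)) , (λ b≡y → y≢b (sym b≡y))) ≤-refl)
                   (Adj⇒distLe G (x≢c , y≢d) ≤-refl)

  escape-G : ∀ {p q} → G.Adj p q → Escape G p q
  escape-G {a , b} {c , d} (a≢c , _) with avoid 3≤t b d
  ... | y , y≢b , y≢d =
    (c , y) , (a≢c , λ b≡y → y≢b (sym b≡y)) , (λ (_ , y≡d) → y≢d y≡d) , λ (c≢c , _) → c≢c refl

  mmd-G⇒nonadjacent : ∀ {p q} → MMD G p q → ¬ G.Adj p q
  mmd-G⇒nonadjacent = mmd⇒nonadjacent G escape-G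

  mmd-G-of-aligned : ∀ {p q} → ¬ p G.≈ q → Aligned p q → MMD G p q
  mmd-G-of-aligned p≉q al = mmd-of-nonadjacent G diameter-G p≉q (aligned⇒nonadjacent al)

  boundary-G : ∀ p → InBoundary G p
  boundary-G (a , b) with avoid 3≤t b b
  ... | y , y≢b , _ =
    (a , y) , maxDist-of-nonadjacent G diameter-G (λ (_ , y≡b) → y≢b y≡b) (aligned⇒nonadjacent (inj₁ refl))

  rookVertex : G.V → Rook.V
  rookVertex p = p , boundary-G p

  _≈?_ : ∀ p q → Dec (p G.≈ q)
  (a , b) ≈? (c , d) = (a ≟ c) ×-dec (b ≟ d)

  rook-adjacent-of-aligned : ∀ {p q} → ¬ p G.≈ q → Aligned p q → Rook.Adj (rookVertex p) (rookVertex q)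
  rook-adjacent-of-aligned p≉q al = p≉q , mmd-G-of-aligned p≉q al

  rook-nonadjacent-of-adjacent : ∀ {p q} → G.Adj p q → ¬ Rook.Adj (rookVertex p) (rookVertex q)
  rook-nonadjacent-of-adjacent pq (_ , mmd) = mmd-G⇒nonadjacent mmd pq

  adjacent-of-¬mmd-G : ∀ {p q} → ¬ p G.≈ q → ¬ MMD G p q → G.Adj p q
  adjacent-of-¬mmd-G p≉q ¬mmd =
      (λ a≡c → ¬mmd (mmd-G-of-aligned p≉q (inj₁ a≡c)))
    , (λ b≡d → ¬mmd (mmd-G-of-aligned p≉q (inj₂ b≡d)))

  aligned⇒rook-distLe : ∀ {x y} → Aligned (proj₁ x) (proj₁ y) → DistLe Rook x y 1
  aligned⇒rook-distLe {x} {y} al with proj₁ x ≈? proj₁ y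
  ... | yes x≈y = ≈⇒distLe Rook x≈y
  ... | no x≉y = Adj⇒distLe Rook (rook-adjacent-of-aligned x≉y al) ≤-refl

  -- (a , b) and (c , d) are both aligned with (a , d).
  diameter-Rook : Diameter≤2 Rook
  diameter-Rook x@((a , _) , _) y@((_ , d) , _) =
    distLe-trans Rook (aligned⇒rook-distLe {x} {rookVertex (a , d)} (inj₁ refl))
                      (aligned⇒rook-distLe {rookVertex (a , d)} {y} (inj₂ refl))

  escape-Rook : ∀ {x y} → Rook.Adj x y → Escape Rook x y
  escape-Rook {(a , b) , _} {(c , d) , _} (x≉y , mmd)
    with nonadjacent⇒aligned (mmd-G⇒nonadjacent mmd) | avoid 3≤r a a | avoid 3≤t b b
  ... | inj₁ refl | a′ , a′≢a , _ | _ =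
      rookVertex (a′ , b)
    , rook-adjacent-of-aligned (λ (a≡a′ , _) → a′≢a (sym a≡a′)) (inj₂ refl)
    , (λ (a′≡a , _) → a′≢a a′≡a)
    , rook-nonadjacent-of-adjacent ((λ a≡a′ → a′≢a (sym a≡a′)) , (λ d≡b → x≉y (refl , sym d≡b)))
  ... | inj₂ refl | _ | b′ , b′≢b , _ =
      rookVertex (a , b′)
    , rook-adjacent-of-aligned (λ (_ , b≡b′) → b′≢b (sym b≡b′)) (inj₁ refl)
    , (λ (_ , b′≡b) → b′≢b b′≡b)
    , rook-nonadjacent-of-adjacent ((λ c≡a → x≉y (sym c≡a , refl)) , (λ b≡b′ → b′≢b (sym b≡b′)))

  mmd-Rook⇒nonadjacent : ∀ {x y} → MMD Rook x y → ¬ Rook.Adj x y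
  mmd-Rook⇒nonadjacent = mmd⇒nonadjacent Rook λ {x} {y} → escape-Rook {x} {y}

  boundary-Rook : ∀ x → InBoundary Rook x
  boundary-Rook x@((a , b) , _) with avoid 3≤r a a | avoid 3≤t b b
  ... | a′ , a′≢a , _ | b′ , b′≢b , _ =
      rookVertex (a′ , b′)
    , maxDist-of-nonadjacent Rook diameter-Rook (λ (a′≡a , _) → a′≢a a′≡a)
        (rook-nonadjacent-of-adjacent (a′≢a , b′≢b))

  SR-Rook≅G : SR Rook ≅ G
  SR-Rook≅G = record
    { to = λ x → proj₁ (proj₁ x)
    ; from = λ p → rookVertex p , boundary-Rook (rookVertex p)
    ; to-cong = λ p≈q → p≈q
    ; from-cong = λ p≈q → p≈q
    ; from-to = λ _ → refl , refl
    ; to-from = λ _ → refl , refl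
    ; to-adj = λ (x≉y , mmd) →
        adjacent-of-¬mmd-G x≉y λ mmd-G → mmd-Rook⇒nonadjacent mmd (x≉y , mmd-G)
    ; adj-to = λ pq → G.Adj-irr pq
                    , mmd-of-nonadjacent Rook diameter-Rook (G.Adj-irr pq) (rook-nonadjacent-of-adjacent pq)
    }

corollary32 : (r t : ℕ) → 3 ≤ r → 3 ≤ t → SR (SR (K r ×ᴳ K t)) ≅ (K r ×ᴳ K t)
corollary32 r t 3≤r 3≤t = DirectProductOfCompleteGraphs.SR-Rook≅G 3≤r 3≤t
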